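{- Write $f(u)=\sum_{i=i_0}^pa_iu^i$ with $a_{i_0}\neq0$, and put $n_0=e\,v_p(a_1)$ if $i_0=1$, and $n_0=\max\{n\in\mathbb Z: i_0^n\le e(i_0-1)v_p(a_{i_0})+1\}$ if $i_0\neq1$. Then the following are equivalent: (a) $f^{(n)}(\pi)\neq0$ for every $n\ge1$; (b) $f^{(n)}(\pi)\neq0$ for every $1\le n\le n_0$.
   Context: Let $p$ be a prime, $K$ a complete discrete valuation field of characteristic $0$ with perfect residue field of characteristic $p$ and absolute ramification index $e$, $\pi$ a uniformizer of $K$, $v_p$ the valuation with $v_p(p)=1$. Let $f(u)=u^p+a_{p-1}u^{p-1}+\cdots+a_1u\in\mathbb Z_p[u]$ with $f(u)\equiv u^p\bmod p$ (so $a_p=1$), and let $f^{(n)}$ denote the $n$-fold composite $f\circ\cdots\circ f$. -}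

module Defs where

open import Level using (0ℓ)
open import Algebra.Bundles using (CommutativeRing)
open import Data.Nat as ℕ using (ℕ; zero; suc)
open import Data.Integer as ℤ using (ℤ; +_; -[1+_])
open import Data.Product using (Σ; ∃; ∃-syntax; _×_; _,_)
open import Relation.Nullary using (¬_)
open import Relation.Binary.PropositionalEquality using (_≡_)

data ℤ∞ : Set where
  fin : ℤ → ℤ∞
  ∞   : ℤ∞

infix 4 _≤∞_
data _≤∞_ : ℤ∞ → ℤ∞ → Set where
  fin≤fin : ∀ {a b} → a ℤ.≤ b → fin a ≤∞ fin b
  _≤∞∞    : ∀ x → x ≤∞ ∞

infixl 6 _+∞_
_+∞_ : ℤ∞ → ℤ∞ → ℤ∞
fin a +∞ fin b = fin (a ℤ.+ b)
fin _ +∞ ∞     = ∞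
∞     +∞ _     = ∞

min∞ : ℤ∞ → ℤ∞ → ℤ∞
min∞ (fin a) (fin b) = fin (a ℤ.⊓ b)
min∞ (fin a) ∞       = fin a
min∞ ∞       y       = y

module RingOps (R : CommutativeRing 0ℓ 0ℓ) where
  open CommutativeRing R

  pow : Carrier → ℕ → Carrier
  pow x zero    = 1#
  pow x (suc n) = x * pow x n

  ιℕ : ℕ → Carrier
  ιℕ zero    = 0#
  ιℕ (suc n) = 1# + ιℕ n

  ιℤ : ℤ → Carrier
  ιℤ (+ n)     = ιℕ n
  ιℤ -[1+ n ]  = - ιℕ (suc n)

  polyEval : (ℕ → Carrier) → ℕ → Carrier → Carrier
  polyEval a zero    u = a 0 * pow u 0
  polyEval a (suc n) u = polyEval a n u + a (suc n) * pow u (suc n)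

  iter : (Carrier → Carrier) → ℕ → Carrier → Carrier
  iter g zero    x = x
  iter g (suc n) x = g (iter g n x)

-- A complete discrete valuation field of characteristic 0 whose residue field
-- is perfect of characteristic p, with normalised valuation v : K → ℤ ∪ {∞}.
record CDVF (p : ℕ) (R : CommutativeRing 0ℓ 0ℓ) : Set₁ where
  open CommutativeRing R
  open RingOps R
  field
    nontrivial : ¬ (1# ≈ 0#)
    inverse    : ∀ x → ¬ (x ≈ 0#) → ∃[ y ] (x * y ≈ 1#)
    char0      : ∀ n → ¬ (ιℕ (suc n) ≈ 0#)
    v          : Carrier → ℤ∞
    v-cong     : ∀ {x y} → x ≈ y → v x ≡ v y
    v-∞⇒0      : ∀ x → v x ≡ ∞ → x ≈ 0#
    v-0⇒∞      : ∀ x → x ≈ 0# → v x ≡ ∞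
    v-mul      : ∀ x y → v (x * y) ≡ v x +∞ v y
    v-add      : ∀ x y → min∞ (v x) (v y) ≤∞ v (x + y)
    -- residue field has characteristic p  (p ∈ maximal ideal)
    residue-char : fin (+ 1) ≤∞ v (ιℕ p)
    -- residue field is perfect: every residue class has a p-th root
    residue-perfect : ∀ x → fin (+ 0) ≤∞ v x →
      ∃[ y ] (fin (+ 0) ≤∞ v y × fin (+ 1) ≤∞ v (pow y p - x))
    complete : (s : ℕ → Carrier) →
      (∀ (m : ℤ) → ∃[ N ] (∀ i j → N ℕ.≤ i → N ℕ.≤ j → fin m ≤∞ v (s i - s j))) →
      ∃[ L ] (∀ (m : ℤ) → ∃[ N ] (∀ i → N ℕ.≤ i → fin m ≤∞ v (s i - L)))

module _ {p : ℕ} {R : CommutativeRing 0ℓ 0ℓ} (K : CDVF p R) where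
  open CommutativeRing R
  open RingOps R
  open CDVF K

  -- x lies in (the image of) ℤ_p ⊆ K, i.e. in the closure of ℤ in K
  IsZp : Carrier → Set
  IsZp x = ∀ (m : ℕ) → ∃[ z ] (fin (+ m) ≤∞ v (x - ιℤ z))

  -- n₀ as in the statement, for given i₀ and coefficients a
  -- (e·v_p(a_i) = v(a_i) since v is normalised with v(p) = e)
  IsN0 : (a : ℕ → Carrier) → (i₀ n₀ : ℕ) → Set
  IsN0 a i₀ n₀ =
    (i₀ ≡ 1 → v (a 1) ≡ fin (+ n₀)) ×
    (¬ (i₀ ≡ 1) → ∃[ k ] (v (a i₀) ≡ fin (+ k) ×
        (i₀ ℕ.^ n₀ ℕ.≤ (i₀ ℕ.∸ 1) ℕ.* k ℕ.+ 1) ×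
        ((i₀ ℕ.∸ 1) ℕ.* k ℕ.+ 1 ℕ.< i₀ ℕ.^ suc n₀)))

{-# OPTIONS --safe #-}
module Submission where

-- Let Sⱼ = 1 + i₀ + ⋯ + i₀ʲ, so S₀ = 1 and Sⱼ₊₁ = i₀ Sⱼ + 1. Since v(a_i) ≥ e ≥ 1 for
-- 0 < i < p, when i₀ < p the map f sends valuation ≥ s ≥ 1 into valuation ≥ i₀ s + 1,
-- so v(f⁽ʲ⁾(π)) ≥ Sⱼ.
-- On the other hand a nonzero root x of f has v(x) ≤ v(a_{i₀}), because the lowest term
-- a_{i₀} x^{i₀} must cancel against the higher ones. The definition of n₀ is exactly
-- v(a_{i₀}) < S_{n₀}, so from step n₀ on the orbit is too deep to hit a root of f.
-- When i₀ = p the same argument runs with v(a_p) = 0 and the bound v(f⁽ʲ⁾(π)) ≥ 1.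

open import Defs
open import Level using (0ℓ)
open import Algebra.Bundles using (CommutativeRing)
open import Data.Nat as ℕ using (ℕ; zero; suc; _≤_; _<_; _^_; z≤n; s≤s; _≤?_; _<?_; _≟_)
import Data.Nat.Properties as ℕₚ
open import Data.Nat.Primality using (Prime)
open import Data.Nat.Tactic.RingSolver using (solve-∀)
open import Data.Integer as ℤ using (+_; -[1+_]; +≤+)
import Data.Integer.Properties as ℤₚ
open import Algebra.Properties.AbelianGroup ℤₚ.+-0-abelianGroup using (identityʳ-unique)
open import Data.Product using (_×_; _,_; ∃-syntax; proj₂)
open import Data.Sum using (inj₁; inj₂)
open import Data.Empty using (⊥-elim)
open import Function.Bundles using (_⇔_; mk⇔)
open import Relation.Nullary using (¬_; yes; no; contradiction)
open import Relation.Binary.PropositionalEquality as ≡ using (_≡_; refl)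

≤∞-trans : ∀ {x y z} → x ≤∞ y → y ≤∞ z → x ≤∞ z
≤∞-trans (fin≤fin a≤b) (fin≤fin b≤c) = fin≤fin (ℤₚ.≤-trans a≤b b≤c)
≤∞-trans _             (_ ≤∞∞)       = _ ≤∞∞

+∞-mono-≤∞ : ∀ {a b x y} → fin a ≤∞ x → fin b ≤∞ y → fin (a ℤ.+ b) ≤∞ x +∞ y
+∞-mono-≤∞ (fin≤fin a≤x) (fin≤fin b≤y) = fin≤fin (ℤₚ.+-mono-≤ a≤x b≤y)
+∞-mono-≤∞ (fin≤fin _)   (_ ≤∞∞)       = _ ≤∞∞
+∞-mono-≤∞ (_ ≤∞∞)       _             = _ ≤∞∞

min∞-greatest : ∀ {c x y} → fin c ≤∞ x → fin c ≤∞ y → fin c ≤∞ min∞ x y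
min∞-greatest (fin≤fin c≤x) (fin≤fin c≤y) = fin≤fin (ℤₚ.⊓-glb c≤x c≤y)
min∞-greatest (fin≤fin c≤x) (_ ≤∞∞)       = fin≤fin c≤x
min∞-greatest (_ ≤∞∞)       c≤y           = c≤y

geometricSum : ℕ → ℕ → ℕ
geometricSum i zero    = 1
geometricSum i (suc n) = suc (i ℕ.* geometricSum i n)

geometricSum-positive : ∀ i n → 1 ≤ geometricSum i n
geometricSum-positive i zero    = s≤s z≤n
geometricSum-positive i (suc n) = s≤s z≤n

geometricSum-mono : ∀ i {m n} → m ≤ n → geometricSum i m ≤ geometricSum i n
geometricSum-mono i {zero}  {n}     _         = geometricSum-positive i n
geometricSum-mono i {suc m} {suc n} (s≤s m≤n) = s≤s (ℕₚ.*-monoʳ-≤ i (geometricSum-mono i m≤n))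

geometricSum-1 : ∀ n → geometricSum 1 n ≡ suc n
geometricSum-1 zero    = refl
geometricSum-1 (suc n) = ≡.cong suc (≡.trans (ℕₚ.*-identityˡ _) (geometricSum-1 n))

geometricSum-closedForm : ∀ c n → c ℕ.* geometricSum (suc c) n ℕ.+ 1 ≡ suc c ^ suc n
geometricSum-closedForm c zero    = base c
  where
  base : ∀ c → c ℕ.* 1 ℕ.+ 1 ≡ suc c ℕ.* 1
  base = solve-∀
geometricSum-closedForm c (suc n) = begin
  c ℕ.* suc (suc c ℕ.* s) ℕ.+ 1  ≡⟨ distribute c s ⟩
  suc c ℕ.* (c ℕ.* s ℕ.+ 1)      ≡⟨ ≡.cong (suc c ℕ.*_) (geometricSum-closedForm c n) ⟩
  suc c ℕ.* suc c ^ suc n        ∎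
  where
  open ≡.≡-Reasoning
  s = geometricSum (suc c) n
  distribute : ∀ c s → c ℕ.* suc (suc c ℕ.* s) ℕ.+ 1 ≡ suc c ℕ.* (c ℕ.* s ℕ.+ 1)
  distribute = solve-∀

geometricSum-bound : ∀ c k n → c ℕ.* k ℕ.+ 1 < suc c ^ suc n → k < geometricSum (suc c) n
geometricSum-bound c k n lt rewrite ≡.sym (geometricSum-closedForm c n) =
  ℕₚ.*-cancelˡ-< c k _ (ℕₚ.+-cancelʳ-< 1 (c ℕ.* k) _ lt)

module Valuation {p : ℕ} {R : CommutativeRing 0ℓ 0ℓ} (K : CDVF p R) where
  open CommutativeRing R hiding (refl)
  open RingOps R
  open CDVF K
  open import Algebra.Properties.Ring ring using (-1*x≈-x; -‿involutive)
  open import Algebra.Properties.AbelianGroup +-abelianGroup using (inverseˡ-unique)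

  infix 4 _≤v_
  _≤v_ : ℕ → Carrier → Set
  n ≤v x = fin (+ n) ≤∞ v x

  v-1# : v 1# ≡ fin (+ 0)
  v-1# with v 1# in v1≡
  ... | ∞     = ⊥-elim (nontrivial (v-∞⇒0 1# v1≡))
  ... | fin z = ≡.cong fin (identityʳ-unique z z (fin-injective (begin
    fin (z ℤ.+ z)   ≡⟨ ≡.cong₂ _+∞_ v1≡ v1≡ ⟨
    v 1# +∞ v 1#    ≡⟨ v-mul 1# 1# ⟨
    v (1# * 1#)     ≡⟨ v-cong (*-identityˡ 1#) ⟩
    v 1#            ≡⟨ v1≡ ⟩
    fin z           ∎)))
    where
    open ≡.≡-Reasoning
    fin-injective : ∀ {a b} → fin a ≡ fin b → a ≡ b
    fin-injective refl = refl

  v⇒≤v : ∀ {n x} → v x ≡ fin (+ n) → n ≤v x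
  v⇒≤v vx≡n = ≡.subst (_ ≤∞_) (≡.sym vx≡n) (fin≤fin ℤₚ.≤-refl)

  ≤v⇒≤ : ∀ {n m x} → n ≤v x → v x ≡ fin (+ m) → n ≤ m
  ≤v⇒≤ n≤vx vx≡m with ≡.subst (_ ≤∞_) vx≡m n≤vx
  ... | fin≤fin (+≤+ n≤m) = n≤m

  ≤v-cong : ∀ {n x y} → x ≈ y → n ≤v x → n ≤v y
  ≤v-cong x≈y = ≡.subst (_ ≤∞_) (v-cong x≈y)

  ≤v-weaken : ∀ {m n x} → m ≤ n → n ≤v x → m ≤v x
  ≤v-weaken m≤n = ≤∞-trans (fin≤fin (+≤+ m≤n))

  ≤v-0# : ∀ {n x} → x ≈ 0# → n ≤v x
  ≤v-0# {x = x} x≈0 = ≡.subst (_ ≤∞_) (≡.sym (v-0⇒∞ x x≈0)) (_ ≤∞∞)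

  0≤v-1# : 0 ≤v 1#
  0≤v-1# = v⇒≤v v-1#

  ≤v-* : ∀ {m n x y} → m ≤v x → n ≤v y → m ℕ.+ n ≤v x * y
  ≤v-* {x = x} {y} m≤vx n≤vy = ≡.subst (_ ≤∞_) (≡.sym (v-mul x y)) (+∞-mono-≤∞ m≤vx n≤vy)

  ≤v-+ : ∀ {n x y} → n ≤v x → n ≤v y → n ≤v x + y
  ≤v-+ {x = x} {y} n≤vx n≤vy = ≤∞-trans (min∞-greatest n≤vx n≤vy) (v-add x y)

  0≤v-[-1#] : 0 ≤v - 1#
  0≤v-[-1#] with v (- 1#) in v-1≡
  ... | ∞            = _ ≤∞∞
  ... | fin (+ _)    = fin≤fin (+≤+ z≤n)
  ... | fin -[1+ k ] = contradiction v-1≡0 λ ()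
    where
    open ≡.≡-Reasoning
    v-1≡0 : fin (-[1+ k ] ℤ.+ -[1+ k ]) ≡ fin (+ 0)
    v-1≡0 = begin
      fin (-[1+ k ] ℤ.+ -[1+ k ])  ≡⟨ ≡.cong₂ _+∞_ v-1≡ v-1≡ ⟨
      v (- 1#) +∞ v (- 1#)         ≡⟨ v-mul (- 1#) (- 1#) ⟨
      v (- 1# * - 1#)              ≡⟨ v-cong (trans (-1*x≈-x (- 1#)) (-‿involutive 1#)) ⟩
      v 1#                         ≡⟨ v-1# ⟩
      fin (+ 0)                    ∎

  ≤v-neg : ∀ {n x} → n ≤v x → n ≤v - x
  ≤v-neg {x = x} n≤vx = ≤v-cong (-1*x≈-x x) (≤v-* 0≤v-[-1#] n≤vx)

  ≤v-pow : ∀ {n x} → n ≤v x → ∀ i → i ℕ.* n ≤v pow x i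
  ≤v-pow n≤vx zero    = 0≤v-1#
  ≤v-pow n≤vx (suc i) = ≤v-* n≤vx (≤v-pow n≤vx i)

  v-pow : ∀ {n x} → v x ≡ fin (+ n) → ∀ i → v (pow x i) ≡ fin (+ (i ℕ.* n))
  v-pow vx≡n zero    = v-1#
  v-pow vx≡n (suc i) = ≡.trans (v-mul _ _) (≡.cong₂ _+∞_ vx≡n (v-pow vx≡n i))

  ≤v-polyEval : ∀ (a : ℕ → Carrier) {t x} d → (∀ i → i ≤ d → t ≤v a i * pow x i) → t ≤v polyEval a d x
  ≤v-polyEval a zero    terms = terms 0 z≤n
  ≤v-polyEval a (suc d) terms =
    ≤v-+ (≤v-polyEval a d λ i i≤d → terms i (ℕₚ.m≤n⇒m≤1+n i≤d)) (terms (suc d) ℕₚ.≤-refl)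

  ≤v-vanishing-term : ∀ {t} (a : ℕ → Carrier) {x} i → a i ≈ 0# → t ≤v a i * pow x i
  ≤v-vanishing-term a i aᵢ≈0 = ≤v-0# (trans (*-congʳ aᵢ≈0) (zeroˡ _))

  ≤v-polyEval-monic : ∀ (a : ℕ → Carrier) {d i₀ e s t x} →
    (∀ i → i < i₀ → a i ≈ 0#) → (∀ i → i₀ ≤ i → i < d → e ≤v a i) → a d ≈ 1# → s ≤v x →
    (∀ i → i₀ ≤ i → i < d → t ≤ e ℕ.+ i ℕ.* s) → t ≤ d ℕ.* s → t ≤v polyEval a d x
  ≤v-polyEval-monic a {d} {i₀} {t = t} {x} below middle monic s≤vx t≤middle t≤top = ≤v-polyEval a d term
    where
    term : ∀ i → i ≤ d → t ≤v a i * pow x i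
    term i i≤d with i <? i₀ | ℕₚ.m≤n⇒m<n∨m≡n i≤d
    ... | yes i<i₀ | _        = ≤v-vanishing-term a i (below i i<i₀)
    ... | no i≮i₀  | inj₁ i<d =
      ≤v-weaken (t≤middle i (ℕₚ.≮⇒≥ i≮i₀) i<d) (≤v-* (middle i (ℕₚ.≮⇒≥ i≮i₀) i<d) (≤v-pow s≤vx i))
    ... | no _     | inj₂ refl = ≤v-weaken t≤top (≤v-* (≤v-cong (sym monic) 0≤v-1#) (≤v-pow s≤vx d))

  polyEval-split : ∀ (a : ℕ → Carrier) {i₀ m x} → (∀ i → i < i₀ → a i ≈ 0#) → m ≤v x →
    ∀ {d} → i₀ ≤ d → (∀ i → i₀ < i → i ≤ d → 0 ≤v a i) →
    ∃[ B ] (suc i₀ ℕ.* m ≤v B × polyEval a d x ≈ a i₀ * pow x i₀ + B)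
  polyEval-split a below m≤vx {zero} z≤n _ = 0# , ≤v-0# (reflexive refl) , sym (+-identityʳ _)
  polyEval-split a {i₀} {m} {x} below m≤vx {suc d} i₀≤1+d above with ℕₚ.m≤n⇒m<n∨m≡n i₀≤1+d
  ... | inj₂ refl =
    polyEval a d x , ≤v-polyEval a d (λ i i≤d → ≤v-vanishing-term a i (below i (s≤s i≤d))) , +-comm _ _
  ... | inj₁ i₀<1+d
    with polyEval-split a below m≤vx (ℕₚ.≤-pred i₀<1+d) (λ i i₀<i i≤d → above i i₀<i (ℕₚ.m≤n⇒m≤1+n i≤d))
  ...   | B , B-deep , split =
    B + a (suc d) * pow x (suc d) ,
    ≤v-+ B-deep (≤v-weaken (ℕₚ.*-monoˡ-≤ m i₀<1+d)
                           (≤v-* (above (suc d) i₀<1+d ℕₚ.≤-refl) (≤v-pow m≤vx (suc d)))) ,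
    trans (+-congʳ split) (+-assoc _ _ _)

  root-valuation-≤ : ∀ (a : ℕ → Carrier) {i₀ d k m x} → (∀ i → i < i₀ → a i ≈ 0#) → i₀ ≤ d →
    (∀ i → i₀ < i → i ≤ d → 0 ≤v a i) → v (a i₀) ≡ fin (+ k) → v x ≡ fin (+ m) →
    polyEval a d x ≈ 0# → m ≤ k
  root-valuation-≤ a {i₀} {k = k} {m} {x} below i₀≤d above vaᵢ₀≡k vx≡m root
    with polyEval-split a below (v⇒≤v vx≡m) i₀≤d above
  ... | B , B-deep , split = ℕₚ.+-cancelʳ-≤ (i₀ ℕ.* m) m k (≤v⇒≤ lowest-deep v-lowest)
    where
    lowest : Carrier
    lowest = a i₀ * pow x i₀
    lowest-deep : suc i₀ ℕ.* m ≤v lowest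
    lowest-deep = ≤v-cong (sym (inverseˡ-unique lowest B (trans (sym split) root))) (≤v-neg B-deep)
    v-lowest : v lowest ≡ fin (+ (k ℕ.+ i₀ ℕ.* m))
    v-lowest = ≡.trans (v-mul _ _) (≡.cong₂ _+∞_ vaᵢ₀≡k (v-pow vx≡m i₀))

  deep-roots-vanish : ∀ (a : ℕ → Carrier) {i₀ d k} → (∀ i → i < i₀ → a i ≈ 0#) → i₀ ≤ d →
    (∀ i → i₀ < i → i ≤ d → 0 ≤v a i) → v (a i₀) ≡ fin (+ k) →
    ∀ x → suc k ≤v x → polyEval a d x ≈ 0# → x ≈ 0#
  deep-roots-vanish a below i₀≤d above vaᵢ₀≡k x k<vx root with v x in vx≡ | k<vx
  ... | ∞       | _                  = v-∞⇒0 x vx≡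
  ... | fin (+ m) | fin≤fin (+≤+ k<m) =
    contradiction (root-valuation-≤ a below i₀≤d above vaᵢ₀≡k vx≡ root) (ℕₚ.<⇒≱ k<m)

  orbit-nonzero : ∀ (f : Carrier → Carrier) {k n₀ x} → (∀ y → suc k ≤v y → f y ≈ 0# → y ≈ 0#) →
    (∀ j → n₀ ≤ j → suc k ≤v iter f j x) → ¬ x ≈ 0# →
    (∀ n → 1 ≤ n → n ≤ n₀ → ¬ iter f n x ≈ 0#) → ∀ n → ¬ iter f n x ≈ 0#
  orbit-nonzero f deep-roots far x≉0 early zero = x≉0
  orbit-nonzero f {n₀ = n₀} deep-roots far x≉0 early (suc j) with suc j ≤? n₀
  ... | yes j<n₀ = early (suc j) (s≤s z≤n) j<n₀
  ... | no j≮n₀ = λ root →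
    orbit-nonzero f deep-roots far x≉0 early j (deep-roots _ (far j (ℕₚ.≤-pred (ℕₚ.≰⇒> j≮n₀))) root)

  orbit-geometric : ∀ (a : ℕ → Carrier) {d i₀ e x} → (∀ i → i < i₀ → a i ≈ 0#) →
    (∀ i → i₀ ≤ i → i < d → e ≤v a i) → a d ≈ 1# → 1 ≤ e → i₀ < d → 1 ≤v x →
    ∀ j → geometricSum i₀ j ≤v iter (polyEval a d) j x
  orbit-geometric a below middle monic e≥1 i₀<d 1≤vx zero    = 1≤vx
  orbit-geometric a {i₀ = i₀} below middle monic e≥1 i₀<d 1≤vx (suc j) =
    ≤v-polyEval-monic a below middle monic (orbit-geometric a below middle monic e≥1 i₀<d 1≤vx j)
      (λ i i₀≤i _ → ℕₚ.+-mono-≤ e≥1 (ℕₚ.*-monoˡ-≤ s i₀≤i))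
      (ℕₚ.≤-trans (ℕₚ.+-monoˡ-≤ (i₀ ℕ.* s) (geometricSum-positive i₀ j)) (ℕₚ.*-monoˡ-≤ s i₀<d))
    where
    s : ℕ
    s = geometricSum i₀ j

  orbit-positive : ∀ (a : ℕ → Carrier) {d i₀ e x} → (∀ i → i < i₀ → a i ≈ 0#) →
    (∀ i → i₀ ≤ i → i < d → e ≤v a i) → a d ≈ 1# → 1 ≤ e → 1 ≤ d → 1 ≤v x →
    ∀ j → 1 ≤v iter (polyEval a d) j x
  orbit-positive a below middle monic e≥1 d≥1 1≤vx zero    = 1≤vx
  orbit-positive a {d} {e = e} below middle monic e≥1 d≥1 1≤vx (suc j) =
    ≤v-polyEval-monic a below middle monic (orbit-positive a below middle monic e≥1 d≥1 1≤vx j)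
      (λ i _ _ → ℕₚ.≤-trans e≥1 (ℕₚ.m≤m+n e _))
      (ℕₚ.≤-trans d≥1 (ℕₚ.≤-reflexive (≡.sym (ℕₚ.*-identityʳ d))))

  IsN0⇒valuation< : ∀ (a : ℕ → Carrier) {i₀ n₀} → 1 ≤ i₀ → IsN0 K a i₀ n₀ →
    ∃[ k ] (v (a i₀) ≡ fin (+ k) × k < geometricSum i₀ n₀)
  IsN0⇒valuation< a {suc c} {n₀} _ (if-linear , if-nonlinear) with suc c ≟ 1
  ... | yes refl = n₀ , if-linear refl , ℕₚ.≤-reflexive (≡.sym (geometricSum-1 n₀))
  ... | no i₀≢1 with if-nonlinear i₀≢1
  ...   | k , vaᵢ₀≡k , _ , k-small = k , vaᵢ₀≡k , geometricSum-bound c k n₀ k-small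

  orbit-eventually-deep : ∀ (a : ℕ → Carrier) {e i₀ n₀ x} → 1 ≤ i₀ → i₀ ≤ p →
    (∀ i → i < i₀ → a i ≈ 0#) → (∀ i → i₀ ≤ i → i < p → e ≤v a i) → a p ≈ 1# → 1 ≤ e →
    IsN0 K a i₀ n₀ → 1 ≤v x →
    ∃[ k ] (v (a i₀) ≡ fin (+ k) × ∀ j → n₀ ≤ j → suc k ≤v iter (polyEval a p) j x)
  orbit-eventually-deep a {i₀ = i₀} i₀≥1 i₀≤p below middle monic e≥1 isN0 1≤vx with i₀ <? p
  ... | no i₀≮p =
    0 , vaᵢ₀≡0 , λ j _ → orbit-positive a below middle monic e≥1 (ℕₚ.≤-trans i₀≥1 i₀≤p) 1≤vx j
    where
    vaᵢ₀≡0 : v (a i₀) ≡ fin (+ 0)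
    vaᵢ₀≡0 = ≡.trans (≡.cong (λ i → v (a i)) (ℕₚ.≤-antisym i₀≤p (ℕₚ.≮⇒≥ i₀≮p))) (≡.trans (v-cong monic) v-1#)
  ... | yes i₀<p with IsN0⇒valuation< a i₀≥1 isN0
  ...   | k , vaᵢ₀≡k , k<S = k , vaᵢ₀≡k , λ j n₀≤j →
    ≤v-weaken (ℕₚ.≤-trans k<S (geometricSum-mono i₀ n₀≤j))
              (orbit-geometric a below middle monic e≥1 i₀<p 1≤vx j)

mainTheorem17 : (p : ℕ) → Prime p → (R : CommutativeRing 0ℓ 0ℓ) → (K : CDVF p R) →
    let open CommutativeRing R
        open RingOps R
        open CDVF K
    in (e : ℕ) → v (ιℕ p) ≡ fin (+ e) →
       (π : Carrier) → v π ≡ fin (+ 1) →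
       (a : ℕ → Carrier) → a 0 ≈ 0# → a p ≈ 1# →
       (∀ i → 1 ≤ i → i < p → IsZp K (a i) × (fin (+ e) ≤∞ v (a i))) →
       (i₀ : ℕ) → 1 ≤ i₀ → i₀ ≤ p → ¬ (a i₀ ≈ 0#) → (∀ i → 1 ≤ i → i < i₀ → a i ≈ 0#) →
       (n₀ : ℕ) → IsN0 K a i₀ n₀ →
       ((∀ n → 1 ≤ n → ¬ (iter (polyEval a p) n π ≈ 0#)) ⇔
        (∀ n → 1 ≤ n → n ≤ n₀ → ¬ (iter (polyEval a p) n π ≈ 0#)))
-- Of the coefficients only v(aᵢ) ≥ e is used.
mainTheorem17 p _ R K e vp≡e π vπ≡1 a a₀≈0 aₚ≈1 coeffs i₀ i₀≥1 i₀≤p _ lower n₀ isN0 =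
  mk⇔ (λ never n n≥1 _ → never n n≥1) (λ early n _ → orbit-avoids-0 early n)
  where
  open CommutativeRing R hiding (refl)
  open RingOps R
  open CDVF K
  open Valuation K

  below : ∀ i → i < i₀ → a i ≈ 0#
  below zero    _    = a₀≈0
  below (suc i) i<i₀ = lower (suc i) (s≤s z≤n) i<i₀

  middle : ∀ i → i₀ ≤ i → i < p → e ≤v a i
  middle i i₀≤i i<p = proj₂ (coeffs i (ℕₚ.≤-trans i₀≥1 i₀≤i) i<p)

  above : ∀ i → i₀ < i → i ≤ p → 0 ≤v a i
  above i i₀<i i≤p with ℕₚ.m≤n⇒m<n∨m≡n i≤p
  ... | inj₁ i<p  = ≤v-weaken z≤n (middle i (ℕₚ.<⇒≤ i₀<i) i<p)
  ... | inj₂ refl = ≤v-cong (sym aₚ≈1) 0≤v-1#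

  π≉0 : ¬ π ≈ 0#
  π≉0 π≈0 with ≡.trans (≡.sym vπ≡1) (v-0⇒∞ π π≈0)
  ... | ()

  orbit-avoids-0 : (∀ n → 1 ≤ n → n ≤ n₀ → ¬ iter (polyEval a p) n π ≈ 0#) →
    ∀ n → ¬ iter (polyEval a p) n π ≈ 0#
  orbit-avoids-0 early
    with orbit-eventually-deep a i₀≥1 i₀≤p below middle aₚ≈1 (≤v⇒≤ residue-char vp≡e) isN0 (v⇒≤v vπ≡1)
  ... | k , vaᵢ₀≡k , far =
    orbit-nonzero (polyEval a p) (deep-roots-vanish a below i₀≤p above vaᵢ₀≡k) far π≉0 early
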